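{- Let $(n,k)\in\mathbb{N}^2$ with $0\le k\le n$. If $k$ and $n$ are both even, then ${\rm Nim}(\mathcal{J}(n,k))=\binom{n}{k}\bmod 2$.
   Context: Chomp on a finite poset $P$ with global minimum $0$: two players alternately pick an element $x$ of the remaining poset and remove all elements $\ge x$; the player forced to pick $0$ loses. ${\rm Nim}(\{0\})=0$ and ${\rm Nim}(P)=\mathrm{mex}\{{\rm Nim}(P_x) : x\in P\setminus\{0\}\}$, where $P_x$ is $P$ with the up-set of $x$ removed. A finite graph is regarded as the poset of the empty set, its vertices and its edges ordered by inclusion. The Johnson graph $\mathcal{J}(n,k)$ has as vertices the $k$-element subsets of an $n$-element set, two vertices adjacent iff the sets intersect in exactly $k-1$ elements. -}

module Defs where

open import Data.Nat using (ℕ; zero; suc; _+_)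
open import Data.Nat.Properties using () renaming (_≟_ to _≟ℕ_)
open import Data.Bool using (Bool; true; false; not; _∨_; _∧_; if_then_else_)
open import Data.Bool.Properties using () renaming (_≟_ to _≟B_)
open import Data.List using (List; []; _∷_; map; filter; length; concatMap; _++_)
open import Data.Vec using (Vec; []; _∷_)
open import Data.Vec.Properties using (≡-dec)
open import Data.Fin.Subset using (Subset; _∩_; ∣_∣)
open import Relation.Nullary using (Dec; yes; no; ¬_)
open import Relation.Nullary.Decidable using (⌊_⌋)
open import Relation.Binary.PropositionalEquality using (_≡_)
open import Data.Product using (_×_; _,_; proj₁; proj₂)

record FinPoset : Set₁ where
  field
    Carrier : Set
    elems   : List Carrier            -- every element listed exactly once
    _≤?_    : Carrier → Carrier → Bool
    _≟_     : (x y : Carrier) → Dec (x ≡ y)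
    bot     : Carrier

member : ℕ → List ℕ → Bool
member x []       = false
member x (y ∷ ys) = ⌊ x ≟ℕ y ⌋ ∨ member x ys

mexFrom : ℕ → ℕ → List ℕ → ℕ
mexFrom zero    i l = i
mexFrom (suc f) i l = if member i l then mexFrom f (suc i) l else i

-- least natural number not in l (it is ≤ length l)
mex : List ℕ → ℕ
mex l = mexFrom (suc (length l)) 0 l

-- A position is the list of remaining elements (a down-set containing 0).  The recursion is on a fuel parameter; since every
-- move removes at least x itself, fuel = number of remaining elements
-- suffices, so the fuel never runs out on a genuine position.

module Chomp (P : FinPoset) where
  open FinPoset P

  remove : Carrier → List Carrier → List Carrier
  remove x S = filter (λ y → Relation.Nullary.¬? (toDec (x ≤? y))) S
    where
      open import Relation.Nullary using (¬?)
      toDec : (b : Bool) → Dec (b ≡ true)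
      toDec b = b ≟B true

  nonBot : List Carrier → List Carrier
  nonBot S = filter (λ y → Relation.Nullary.¬? (y ≟ bot)) S

  nimF : ℕ → List Carrier → ℕ
  nimF zero    S = 0
  nimF (suc f) S = mex (map (λ x → nimF f (remove x S)) (nonBot S))

  nimPos : List Carrier → ℕ
  nimPos S = nimF (length S) S

  nim : ℕ
  nim = nimPos elems

-- A finite simple graph as a poset: ∅ < vertices < edges (inclusion).

data GElem (V : Set) : Set where
  gbot  : GElem V
  gvert : V → GElem V
  gedge : V → V → GElem V     -- an edge {u , v}, stored once

module GraphPoset {V : Set} (_≟V_ : (x y : V) → Dec (x ≡ y)) where

  eqB : V → V → Bool
  eqB x y = ⌊ x ≟V y ⌋

  leG : GElem V → GElem V → Bool
  leG gbot        _             = true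
  leG (gvert u)   gbot          = false
  leG (gvert u)   (gvert v)     = eqB u v
  leG (gvert u)   (gedge a b)   = eqB u a ∨ eqB u b
  leG (gedge a b) gbot          = false
  leG (gedge a b) (gvert v)     = false
  leG (gedge a b) (gedge c d)   = eqB a c ∧ eqB b d

  eqG : (x y : GElem V) → Dec (x ≡ y)
  eqG gbot gbot = yes Relation.Binary.PropositionalEquality.refl
  eqG gbot (gvert _) = no (λ ())
  eqG gbot (gedge _ _) = no (λ ())
  eqG (gvert _) gbot = no (λ ())
  eqG (gvert u) (gvert v) with u ≟V v
  ... | yes Relation.Binary.PropositionalEquality.refl = yes Relation.Binary.PropositionalEquality.refl
  ... | no u≢v = no (λ { Relation.Binary.PropositionalEquality.refl → u≢v Relation.Binary.PropositionalEquality.refl })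
  eqG (gvert _) (gedge _ _) = no (λ ())
  eqG (gedge _ _) gbot = no (λ ())
  eqG (gedge _ _) (gvert _) = no (λ ())
  eqG (gedge a b) (gedge c d) with a ≟V c | b ≟V d
  ... | yes Relation.Binary.PropositionalEquality.refl | yes Relation.Binary.PropositionalEquality.refl = yes Relation.Binary.PropositionalEquality.refl
  ... | no a≢c | _ = no (λ { Relation.Binary.PropositionalEquality.refl → a≢c Relation.Binary.PropositionalEquality.refl })
  ... | yes _ | no b≢d = no (λ { Relation.Binary.PropositionalEquality.refl → b≢d Relation.Binary.PropositionalEquality.refl })

  -- graph given by a duplicate-free vertex list and a duplicate-free edge
  -- list (each edge as one ordered pair of distinct vertices)
  graphPoset : List V → List (V × V) → FinPoset
  graphPoset vs es = record
    { Carrier = GElem V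
    ; elems   = gbot ∷ (map gvert vs ++ map (λ e → gedge (proj₁ e) (proj₂ e)) es)
    ; _≤?_    = leG
    ; _≟_     = eqG
    ; bot     = gbot
    }

allSubsets : (n : ℕ) → List (Subset n)
allSubsets zero    = [] ∷ []
allSubsets (suc n) = map (false ∷_) (allSubsets n) ++ map (true ∷_) (allSubsets n)

kSubsets : (n k : ℕ) → List (Subset n)
kSubsets n k = filter (λ s → ∣ s ∣ ≟ℕ k) (allSubsets n)

pairs : {A : Set} → List A → List (A × A)
pairs []       = []
pairs (x ∷ xs) = map (λ y → (x , y)) xs ++ pairs xs

-- s, t adjacent iff |s ∩ t| = k - 1 (written |s ∩ t| + 1 = k)
johnsonEdges : (n k : ℕ) → List (Subset n × Subset n)
johnsonEdges n k =
  filter (λ e → ∣ proj₁ e ∩ proj₂ e ∣ + 1 ≟ℕ k) (pairs (kSubsets n k))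

subsetEq : {n : ℕ} → (x y : Subset n) → Dec (x ≡ y)
subsetEq = ≡-dec _≟B_

johnsonPoset : (n k : ℕ) → FinPoset
johnsonPoset n k = GraphPoset.graphPoset subsetEq (kSubsets n k) (johnsonEdges n k)

nimJohnson : (n k : ℕ) → ℕ
nimJohnson n k = Chomp.nim (johnsonPoset n k)

-- Let σ be the involution of the k-subsets of {0,…,n-1} that exchanges the
-- points 2i and 2i+1; it is an automorphism of the Chomp poset of J(n,k).
-- If the σ-fixed elements form a down-set and no element lies below its
-- mirror image, then a σ-symmetric position has the Nim value of its fixed
-- part: a move off the fixed part is answered by its mirror image, which
-- returns to a symmetric position with the same fixed part.  For n and k
-- even no edge of J(n,k) is fixed (a fixed set has even size, while adjacent
-- k-sets meet in k - 1 points), so the fixed part is the edgeless graph on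
-- the symmetric k-sets and its Nim value is the parity of their number.
-- This number satisfies F(n+2,k+2) = F(n,k+2) + F(n,k), and
-- C(n+2,k+2) = C(n,k+2) + 2 C(n,k+1) + C(n,k) agrees with it modulo 2.
module Submission where

open import Defs
open import Data.Nat using (ℕ; zero; suc; _+_; _*_; _%_; _≤_; _<_; z≤n; s≤s; NonZero)
  renaming (_≟_ to _≟ℕ_)
open import Data.Nat.Properties
  using ( ≤-refl; ≤-trans; ≤-pred; <-trans; <-cmp; <⇒≢; <⇒≱; n≮n; m<n⇒m<1+n; m≤n⇒m<n∨m≡n
        ; +-identityʳ; +-suc; suc-injective)
open import Data.Nat.Divisibility using (_∣_; divides; _∣0; ∣-refl; ∣m∣n⇒∣m+n; ∣m+n∣m⇒∣n; ∣1⇒≡1)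
open import Data.Nat.DivMod using (%-distribˡ-+; [m+kn]%n≡m%n)
open import Data.Nat.Combinatorics using (_C_; nCk+nC[k+1]≡[n+1]C[k+1]; nC1≡n)
open import Data.Nat.Induction using (<-wellFounded)
open import Data.Nat.Tactic.RingSolver using (solve-∀)
open import Data.Bool using (true; false; _∧_)
open import Data.Bool.Properties using (∨-zeroʳ) renaming (_≟_ to _≟B_)
open import Data.Unit using (⊤; tt)
open import Data.Vec using ([]; _∷_)
open import Data.Vec.Properties using (∷-injectiveʳ)
open import Data.Fin.Subset using (Subset; _∩_; ∣_∣)
open import Data.Fin.Subset.Properties using (∩-comm)
open import Data.List using (List; []; _∷_; length; filter; map; _++_)
open import Data.List.Properties
  using ( filter-≐; filter-++; filter-all; filter-none; filter-notAll; filter-reject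
        ; length-++; length-map; map-cong-local; ++-identityʳ)
open import Data.List.Membership.Propositional using (_∈_; _∉_)
open import Data.List.Membership.Propositional.Properties
  using (∈-filter⁺; ∈-filter⁻; ∈-map⁺; ∈-map⁻; ∈-++⁺ˡ; ∈-++⁺ʳ; ∈-++⁻)
open import Data.List.Relation.Unary.Any using (here; there)
import Data.List.Relation.Unary.Any as Any
import Data.List.Relation.Unary.All as All
open import Data.List.Relation.Unary.AllPairs using (AllPairs; []; _∷_)
import Data.List.Relation.Unary.AllPairs as AllPairs
import Data.List.Relation.Unary.AllPairs.Properties as AllPairs
open import Data.List.Relation.Unary.Unique.Propositional using (Unique)
import Data.List.Relation.Unary.Unique.Propositional.Properties as Unique
open import Data.Product using (_×_; _,_; proj₁; proj₂; ∃; swap)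
open import Data.Sum using (_⊎_; inj₁; inj₂)
open import Function using (_∘_; case_of_)
open import Level using (Level)
open import Induction.WellFounded using (Acc; acc)
open import Relation.Nullary using (Dec; yes; no; ¬_; ¬?; _×-dec_; contradiction)
open import Relation.Unary using (Pred; Decidable)
open import Relation.Binary.Definitions
  using (DecidableEquality; Trichotomous; Asymmetric; Tri; tri<; tri≈; tri>)
open import Relation.Binary.Consequences using (tri⇒asym)
open import Relation.Binary.PropositionalEquality

private
  variable
    a b p q : Level
    A : Set a
    B : Set b
    P : Pred A p
    Q : Pred A q

filter-filter : (P? : Decidable P) (Q? : Decidable Q) →
                ∀ xs → filter P? (filter Q? xs) ≡ filter (λ x → Q? x ×-dec P? x) xs
filter-filter P? Q? []       = refl
filter-filter P? Q? (x ∷ xs) with Q? x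
... | no _ = filter-filter P? Q? xs
... | yes _ with P? x
...   | no _  = filter-filter P? Q? xs
...   | yes _ = cong (x ∷_) (filter-filter P? Q? xs)

filter-comm : (P? : Decidable P) (Q? : Decidable Q) →
              ∀ xs → filter P? (filter Q? xs) ≡ filter Q? (filter P? xs)
filter-comm P? Q? xs = begin
  filter P? (filter Q? xs)           ≡⟨ filter-filter P? Q? xs ⟩
  filter (λ x → Q? x ×-dec P? x) xs  ≡⟨ filter-≐ _ _ (swap , swap) xs ⟩
  filter (λ x → P? x ×-dec Q? x) xs  ≡⟨ filter-filter Q? P? xs ⟨
  filter Q? (filter P? xs)           ∎
  where open ≡-Reasoning

filter-map : {P : Pred B p} (P? : Decidable P) (f : A → B) →
             ∀ xs → filter P? (map f xs) ≡ map f (filter (P? ∘ f) xs)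
filter-map P? f []       = refl
filter-map P? f (x ∷ xs) with P? (f x)
... | no _  = filter-map P? f xs
... | yes _ = cong (f x ∷_) (filter-map P? f xs)

length-filter-map : {P : Pred B p} (P? : Decidable P) (f : A → B) →
                    ∀ xs → length (filter P? (map f xs)) ≡ length (filter (P? ∘ f) xs)
length-filter-map P? f xs =
  trans (cong length (filter-map P? f xs)) (length-map f (filter (P? ∘ f) xs))

module _ {A : Set} {R : A → A → Set} where

  ∈-pairs⁻ : ∀ {xs x y} → AllPairs R xs → (x , y) ∈ pairs xs → x ∈ xs × y ∈ xs × R x y
  ∈-pairs⁻ {z ∷ xs} (Rz ∷ sorted) xy∈ with ∈-++⁻ (map (z ,_) xs) xy∈
  ... | inj₁ xy∈head with ∈-map⁻ (z ,_) xy∈head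
  ...   | _ , y∈xs , refl = here refl , there y∈xs , All.lookup Rz y∈xs
  ∈-pairs⁻ (_ ∷ sorted) _ | inj₂ xy∈tail with ∈-pairs⁻ sorted xy∈tail
  ...   | x∈xs , y∈xs , Rxy = there x∈xs , there y∈xs , Rxy

  ∈-pairs⁺ : ∀ {xs x y} → Asymmetric R → AllPairs R xs → x ∈ xs → y ∈ xs → R x y → (x , y) ∈ pairs xs
  ∈-pairs⁺ asym _ (here refl) (here refl) Rxx = contradiction Rxx (asym Rxx)
  ∈-pairs⁺ {z ∷ xs} asym _ (here refl) (there y∈) _ = ∈-++⁺ˡ (∈-map⁺ (z ,_) y∈)
  ∈-pairs⁺ asym (Rz ∷ _) (there x∈) (here refl) Rxy = contradiction (All.lookup Rz x∈) (asym Rxy)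
  ∈-pairs⁺ {z ∷ xs} asym (_ ∷ sorted) (there x∈) (there y∈) Rxy =
    ∈-++⁺ʳ (map (z ,_) xs) (∈-pairs⁺ asym sorted x∈ y∈ Rxy)

member⇒∈ : ∀ {x} L → member x L ≡ true → x ∈ L
member⇒∈ {x} (y ∷ L) eq with x ≟ℕ y
... | yes refl = here refl
... | no _     = there (member⇒∈ L eq)

∈⇒member : ∀ {x L} → x ∈ L → member x L ≡ true
∈⇒member {x} {y ∷ L} x∈ with x ≟ℕ y | x∈
... | yes _  | _         = refl
... | no x≢y | here x≡y  = contradiction x≡y x≢y
... | no _   | there x∈L = ∈⇒member x∈L

initialSegment⊆⇒≤length : ∀ g (L : List ℕ) → (∀ h → h < g → h ∈ L) → g ≤ length L
initialSegment⊆⇒≤length zero    L _     = z≤n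
initialSegment⊆⇒≤length (suc g) L below =
  ≤-trans (s≤s (initialSegment⊆⇒≤length g (filter ≢g? L) below′)) (filter-notAll ≢g? L g∈L)
  where
  ≢g? : Decidable (λ y → y ≢ g)
  ≢g? y = ¬? (y ≟ℕ g)
  below′ : ∀ h → h < g → h ∈ filter ≢g? L
  below′ h h<g = ∈-filter⁺ ≢g? (below h (m<n⇒m<1+n h<g)) (<⇒≢ h<g)
  g∈L : Any.Any (λ y → ¬ y ≢ g) L
  g∈L = Any.map (λ g≡y y≢g → y≢g (sym g≡y)) (below g ≤-refl)

mexFrom-covers : ∀ f i L {h} → i ≤ h → h < mexFrom f i L → h ∈ L
mexFrom-covers zero    i L i≤h h<i = contradiction i≤h (<⇒≱ h<i)
mexFrom-covers (suc f) i L i≤h h<m with member i L in i∈?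
... | false = contradiction i≤h (<⇒≱ h<m)
... | true with m≤n⇒m<n∨m≡n i≤h
...   | inj₁ i<h  = mexFrom-covers f (suc i) L i<h h<m
...   | inj₂ refl = member⇒∈ L i∈?

mexFrom-escapes : ∀ f i L → mexFrom f i L ∉ L ⊎ mexFrom f i L ≡ i + f
mexFrom-escapes zero    i L = inj₂ (sym (+-identityʳ i))
mexFrom-escapes (suc f) i L with member i L in i∈?
... | false = inj₁ (λ i∈L → contradiction (trans (sym (∈⇒member i∈L)) i∈?) λ ())
... | true with mexFrom-escapes f (suc i) L
...   | inj₁ m∉L = inj₁ m∉L
...   | inj₂ m≡  = inj₂ (trans m≡ (sym (+-suc i f)))

<mex⇒∈ : ∀ L {h} → h < mex L → h ∈ L
<mex⇒∈ L = mexFrom-covers (suc (length L)) 0 L z≤n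

mex∉ : ∀ L → mex L ∉ L
mex∉ L with mexFrom-escapes (suc (length L)) 0 L
... | inj₁ m∉L = m∉L
... | inj₂ m≡  = contradiction
      (subst (_≤ length L) m≡ (initialSegment⊆⇒≤length (mex L) L (λ _ → <mex⇒∈ L)))
      (n≮n (length L))

mex-unique : ∀ L g → (∀ {h} → h < g → h ∈ L) → g ∉ L → mex L ≡ g
mex-unique L g below g∉L with <-cmp (mex L) g
... | tri< m<g _ _ = contradiction (below m<g) (mex∉ L)
... | tri≈ _ m≡g _ = m≡g
... | tri> _ _ g<m = contradiction (<mex⇒∈ L g<m) g∉L

mex-constant : ∀ m L → (∀ {v} → v ∈ L → v ≡ m % 2) → m % 2 ∈ L → mex L ≡ suc m % 2
mex-constant zero          L constant 0∈L =
  mex-unique L 1 (λ { (s≤s z≤n) → 0∈L }) (λ 1∈L → case constant 1∈L of λ ())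
mex-constant (suc zero)    L constant 1∈L =
  mex-unique L 0 (λ ()) (λ 0∈L → case constant 0∈L of λ ())
mex-constant (suc (suc m)) = mex-constant m

module ChompProperties (P : FinPoset) (≤?-refl : ∀ x → FinPoset._≤?_ P x x ≡ true) where
  open FinPoset P
  open Chomp P

  _≰_ : Carrier → Carrier → Set
  x ≰ y = ¬ ((x ≤? y) ≡ true)

  ∈-remove⁻ : ∀ {x z S} → z ∈ remove x S → z ∈ S × x ≰ z
  ∈-remove⁻ {x} = ∈-filter⁻ (λ y → ¬? ((x ≤? y) ≟B true))

  ∈-remove⁺ : ∀ {x z S} → z ∈ S → x ≰ z → z ∈ remove x S
  ∈-remove⁺ {x} = ∈-filter⁺ (λ y → ¬? ((x ≤? y) ≟B true))

  remove-shrinks : ∀ {x S} → x ∈ S → length (remove x S) < length S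
  remove-shrinks {x} {S} x∈S =
    filter-notAll _ S (Any.map (λ { refl x≰x → x≰x (≤?-refl x) }) x∈S)

  ∈-nonBot⁻ : ∀ {z S} → z ∈ nonBot S → z ∈ S × z ≢ bot
  ∈-nonBot⁻ = ∈-filter⁻ (λ y → ¬? (y ≟ bot))

  ∈-nonBot⁺ : ∀ {z S} → z ∈ S → z ≢ bot → z ∈ nonBot S
  ∈-nonBot⁺ = ∈-filter⁺ (λ y → ¬? (y ≟ bot))

  nimF-fuel : ∀ f g S → length S ≤ f → length S ≤ g → nimF f S ≡ nimF g S
  nimF-fuel zero    zero    S  _   _   = refl
  nimF-fuel zero    (suc g) [] _   _   = refl
  nimF-fuel (suc f) zero    [] _   _   = refl
  nimF-fuel (suc f) (suc g) S  S≤f S≤g = cong mex (map-cong-local (All.tabulate same-value))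
    where
    same-value : ∀ {x} → x ∈ nonBot S → nimF f (remove x S) ≡ nimF g (remove x S)
    same-value {x} x∈ = nimF-fuel f g (remove x S) (≤-pred (≤-trans shrinks S≤f)) (≤-pred (≤-trans shrinks S≤g))
      where
      shrinks : length (remove x S) < length S
      shrinks = remove-shrinks (proj₁ (∈-nonBot⁻ {S = S} x∈))

  options : List Carrier → List ℕ
  options S = map (λ x → nimPos (remove x S)) (nonBot S)

  nimPos-unfold : ∀ S → nimPos S ≡ mex (options S)
  nimPos-unfold []      = refl
  nimPos-unfold (y ∷ S) = cong mex (map-cong-local (All.tabulate λ {x} x∈ →
    nimF-fuel (length S) (length (remove x (y ∷ S))) (remove x (y ∷ S))
      (≤-pred (remove-shrinks (proj₁ (∈-nonBot⁻ {S = y ∷ S} x∈)))) ≤-refl))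

  ∈-options⁻ : ∀ {v S} → v ∈ options S → ∃ λ x → x ∈ S × x ≢ bot × v ≡ nimPos (remove x S)
  ∈-options⁻ {S = S} v∈ with ∈-map⁻ (λ x → nimPos (remove x S)) v∈
  ... | x , x∈ , v≡ = x , proj₁ (∈-nonBot⁻ {S = S} x∈) , proj₂ (∈-nonBot⁻ {S = S} x∈) , v≡

  ∈-options⁺ : ∀ {x S} → x ∈ S → x ≢ bot → nimPos (remove x S) ∈ options S
  ∈-options⁺ {S = S} x∈S x≢bot = ∈-map⁺ (λ x → nimPos (remove x S)) (∈-nonBot⁺ x∈S x≢bot)

  module MirrorStrategy
    (σ : Carrier → Carrier) (Valid : Carrier → Set)
    (σ-involutive : ∀ {x} → Valid x → σ (σ x) ≡ x)
    (σ-monotone : ∀ {x y} → (x ≤? y) ≡ true → (σ x ≤? σ y) ≡ true)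
    (σ-bot : σ bot ≡ bot)
    (fixed-downClosed : ∀ {x z} → Valid z → (x ≤? z) ≡ true → z ≡ σ z → x ≡ σ x)
    (≰-mirror : ∀ {x} → x ≢ σ x → x ≰ σ x)
    where

    fixed? : Decidable (λ x → x ≡ σ x)
    fixed? x = x ≟ σ x

    fixedPart : List Carrier → List Carrier
    fixedPart = filter fixed?

    record Symmetric (S : List Carrier) : Set where
      field
        valid  : ∀ {z} → z ∈ S → Valid z
        closed : ∀ {z} → z ∈ S → σ z ∈ S
    open Symmetric

    mirror-≤ : ∀ {x z} → Valid z → (x ≤? σ z) ≡ true → (σ x ≤? z) ≡ true
    mirror-≤ {x} vz x≤σz = subst (λ w → (σ x ≤? w) ≡ true) (σ-involutive vz) (σ-monotone x≤σz)

    mirror-nonfixed : ∀ {x} → Valid x → x ≢ σ x → σ x ≢ σ (σ x)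
    mirror-nonfixed vx x≢σx σx≡σσx = x≢σx (sym (trans σx≡σσx (σ-involutive vx)))

    fixedPart-remove : ∀ x S → fixedPart (remove x S) ≡ remove x (fixedPart S)
    fixedPart-remove x S = filter-comm fixed? _ S

    remove-fixedPart : ∀ {y S} → Symmetric S → y ≢ σ y → remove y (fixedPart S) ≡ fixedPart S
    remove-fixedPart {y} {S} symS y≢σy = filter-all _ (All.tabulate y≰fixed)
      where
      y≰fixed : ∀ {z} → z ∈ fixedPart S → y ≰ z
      y≰fixed z∈ y≤z with ∈-filter⁻ fixed? z∈
      ... | z∈S , z≡σz = y≢σy (fixed-downClosed (symS .valid z∈S) y≤z z≡σz)

    fixedPart-remove-pair : ∀ {x S} → Symmetric S → Valid x → x ≢ σ x →
                            fixedPart (remove (σ x) (remove x S)) ≡ fixedPart S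
    fixedPart-remove-pair {x} {S} symS vx x≢σx = begin
      fixedPart (remove (σ x) (remove x S))  ≡⟨ fixedPart-remove (σ x) (remove x S) ⟩
      remove (σ x) (fixedPart (remove x S))  ≡⟨ cong (remove (σ x)) (fixedPart-remove x S) ⟩
      remove (σ x) (remove x (fixedPart S))  ≡⟨ cong (remove (σ x)) (remove-fixedPart symS x≢σx) ⟩
      remove (σ x) (fixedPart S)             ≡⟨ remove-fixedPart symS (mirror-nonfixed vx x≢σx) ⟩
      fixedPart S                            ∎
      where open ≡-Reasoning

    remove-fixed-symmetric : ∀ {x S} → Symmetric S → x ≡ σ x → Symmetric (remove x S)
    remove-fixed-symmetric symS x≡σx .valid z∈ = symS .valid (proj₁ (∈-remove⁻ z∈))
    remove-fixed-symmetric {x} {S} symS x≡σx .closed {z} z∈ with ∈-remove⁻ {x} {z} {S} z∈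
    ... | z∈S , x≰z = ∈-remove⁺ (symS .closed z∈S) λ x≤σz →
      x≰z (subst (λ w → (w ≤? z) ≡ true) (sym x≡σx) (mirror-≤ (symS .valid z∈S) x≤σz))

    remove-pair-symmetric : ∀ {x S} → Symmetric S → Valid x → Symmetric (remove (σ x) (remove x S))
    remove-pair-symmetric symS vx .valid z∈ = symS .valid (proj₁ (∈-remove⁻ (proj₁ (∈-remove⁻ z∈))))
    remove-pair-symmetric {x} {S} symS vx .closed {z} z∈
      with ∈-remove⁻ {σ x} {z} {remove x S} z∈
    ... | z∈T , σx≰z with ∈-remove⁻ {x} {z} {S} z∈T
    ...   | z∈S , x≰z = ∈-remove⁺ (∈-remove⁺ (symS .closed z∈S) x≰σz) σx≰σz
      where
      x≰σz : x ≰ σ z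
      x≰σz x≤σz = σx≰z (mirror-≤ (symS .valid z∈S) x≤σz)
      σx≰σz : σ x ≰ σ z
      σx≰σz σx≤σz =
        x≰z (subst (λ w → (w ≤? z) ≡ true) (σ-involutive vx) (mirror-≤ (symS .valid z∈S) σx≤σz))

    private
      Invariant : List Carrier → Set
      Invariant S = Symmetric S → nimPos S ≡ nimPos (fixedPart S)

    module _ {S} (symS : Symmetric S) (ih : ∀ {T} → length T < length S → Invariant T) where
      open ≡-Reasoning

      <nimFixedPart⇒∈options : ∀ {h} → h < nimPos (fixedPart S) → h ∈ options S
      <nimFixedPart⇒∈options {h} h<g
        with ∈-options⁻ {S = fixedPart S}
               (<mex⇒∈ (options (fixedPart S)) (subst (h <_) (nimPos-unfold (fixedPart S)) h<g))
      ... | x , x∈F , x≢bot , h≡ with ∈-filter⁻ fixed? {xs = S} x∈F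
      ...   | x∈S , x≡σx = subst (_∈ options S) (sym h≡move) (∈-options⁺ x∈S x≢bot)
        where
        h≡move : h ≡ nimPos (remove x S)
        h≡move = begin
          h                                  ≡⟨ h≡ ⟩
          nimPos (remove x (fixedPart S))    ≡⟨ cong nimPos (fixedPart-remove x S) ⟨
          nimPos (fixedPart (remove x S))    ≡⟨ ih (remove-shrinks x∈S) (remove-fixed-symmetric symS x≡σx) ⟨
          nimPos (remove x S)                ∎

      -- The move x is answered by x itself in the fixed part if x is fixed,
      -- and by σ x otherwise; either answer has value nimPos (fixedPart S).
      nimFixedPart∉options : nimPos (fixedPart S) ∉ options S
      nimFixedPart∉options g∈ with ∈-options⁻ {S = S} g∈
      ... | x , x∈S , x≢bot , g≡ with fixed? x
      ...   | yes x≡σx = mex∉ (options (fixedPart S))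
                (subst (_∈ options (fixedPart S)) reply≡ (∈-options⁺ (∈-filter⁺ fixed? x∈S x≡σx) x≢bot))
        where
        reply≡ : nimPos (remove x (fixedPart S)) ≡ mex (options (fixedPart S))
        reply≡ = begin
          nimPos (remove x (fixedPart S))    ≡⟨ cong nimPos (fixedPart-remove x S) ⟨
          nimPos (fixedPart (remove x S))    ≡⟨ ih (remove-shrinks x∈S) (remove-fixed-symmetric symS x≡σx) ⟨
          nimPos (remove x S)                ≡⟨ g≡ ⟨
          nimPos (fixedPart S)               ≡⟨ nimPos-unfold (fixedPart S) ⟩
          mex (options (fixedPart S))        ∎
      ...   | no x≢σx = mex∉ (options T) (subst (_∈ options T) reply≡ (∈-options⁺ σx∈T σx≢bot))
        where
        vx : Valid x
        vx = symS .valid x∈S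
        T : List Carrier
        T = remove x S
        σx∈T : σ x ∈ T
        σx∈T = ∈-remove⁺ (symS .closed x∈S) (≰-mirror x≢σx)
        σx≢bot : σ x ≢ bot
        σx≢bot σx≡bot = x≢bot (trans (sym (σ-involutive vx)) (trans (cong σ σx≡bot) σ-bot))
        reply≡ : nimPos (remove (σ x) T) ≡ mex (options T)
        reply≡ = begin
          nimPos (remove (σ x) T)               ≡⟨ ih (<-trans (remove-shrinks σx∈T) (remove-shrinks x∈S))
                                                      (remove-pair-symmetric symS vx) ⟩
          nimPos (fixedPart (remove (σ x) T))   ≡⟨ cong nimPos (fixedPart-remove-pair symS vx x≢σx) ⟩
          nimPos (fixedPart S)                  ≡⟨ g≡ ⟩
          nimPos T                              ≡⟨ nimPos-unfold T ⟩
          mex (options T)                       ∎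

    nimPos-fixedPart : ∀ S → Symmetric S → nimPos S ≡ nimPos (fixedPart S)
    nimPos-fixedPart S = byLength S (<-wellFounded (length S))
      where
      byLength : ∀ S → Acc _<_ (length S) → Invariant S
      byLength S (acc rs) symS =
        trans (nimPos-unfold S)
              (mex-unique (options S) _ (<nimFixedPart⇒∈options symS ih) (nimFixedPart∉options symS ih))
        where
        ih : ∀ {T} → length T < length S → Invariant T
        ih T<S = byLength _ (rs T<S)

module GraphPosetProperties {V : Set} (_≟V_ : DecidableEquality V) where
  open GraphPoset _≟V_

  eqB-refl : ∀ u → eqB u u ≡ true
  eqB-refl u with u ≟V u
  ... | yes _  = refl
  ... | no u≢u = contradiction refl u≢u

  eqB⇒≡ : ∀ {u v} → eqB u v ≡ true → u ≡ v
  eqB⇒≡ {u} {v} eq with u ≟V v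
  ... | yes u≡v = u≡v

  ≢⇒¬eqB : ∀ {u v} → u ≢ v → eqB u v ≢ true
  ≢⇒¬eqB u≢v eq = u≢v (eqB⇒≡ eq)

  ¬eqB⇒≢ : ∀ {u v} → eqB u v ≢ true → u ≢ v
  ¬eqB⇒≢ {u} ¬eq refl = ¬eq (eqB-refl u)

  gvert-injective : ∀ {u v : V} → gvert u ≡ gvert v → u ≡ v
  gvert-injective refl = refl

  gedge-injective : ∀ {a b c d : V} → gedge a b ≡ gedge c d → a ≡ c × b ≡ d
  gedge-injective refl = refl , refl

  leG-refl : ∀ x → leG x x ≡ true
  leG-refl gbot        = refl
  leG-refl (gvert u)   = eqB-refl u
  leG-refl (gedge a b) rewrite eqB-refl a | eqB-refl b = refl

  below-bot : ∀ x → leG x gbot ≡ true → x ≡ gbot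
  below-bot gbot _ = refl

  edge-maximal : ∀ {a b} y → leG (gedge a b) y ≡ true → y ≡ gedge a b
  edge-maximal {a} {b} (gedge c d) _ with a ≟V c | b ≟V d
  ... | yes refl | yes refl = refl

  vertex-of-edge : ∀ {u a b} → leG (gvert u) (gedge a b) ≡ true → u ≡ a ⊎ u ≡ b
  vertex-of-edge {u} {a} u≤ab with u ≟V a
  ... | yes u≡a = inj₁ u≡a
  ... | no _    = inj₂ (eqB⇒≡ u≤ab)

  vertex≤edgeˡ : ∀ a b → leG (gvert a) (gedge a b) ≡ true
  vertex≤edgeˡ a b rewrite eqB-refl a = refl

  vertex≤edgeʳ : ∀ a b → leG (gvert b) (gedge a b) ≡ true
  vertex≤edgeʳ a b rewrite eqB-refl b = ∨-zeroʳ (eqB b a)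

  module EdgelessChomp (vs : List V) (es : List (V × V)) where
    open Chomp (graphPoset vs es)
    open ChompProperties (graphPoset vs es) leG-refl

    _≢?_ : ∀ u v → Dec (u ≢ v)
    u ≢? v = ¬? (u ≟V v)

    remove-vertex : ∀ u L → remove (gvert u) (gbot ∷ map gvert L) ≡ gbot ∷ map gvert (filter (u ≢?_) L)
    remove-vertex u L = cong (gbot ∷_) (begin
      remove (gvert u) (map gvert L)                      ≡⟨ filter-map _ gvert L ⟩
      map gvert (filter (λ v → ¬? (eqB u v ≟B true)) L)  ≡⟨ cong (map gvert) (filter-≐ _ _ (¬eqB⇒≢ , ≢⇒¬eqB) L) ⟩
      map gvert (filter (u ≢?_) L)                        ∎)
      where open ≡-Reasoning

    length-filter-≢ : ∀ {u L} → Unique L → u ∈ L → suc (length (filter (u ≢?_) L)) ≡ length L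
    length-filter-≢ {u} (u∉L ∷ _) (here refl) =
      cong (suc ∘ length) (trans (filter-reject (u ≢?_) (λ u≢u → u≢u refl)) (filter-all (u ≢?_) u∉L))
    length-filter-≢ {u} {v ∷ L} (v∉L ∷ uniq) (there u∈L) with u ≟V v
    ... | yes refl = contradiction refl (All.lookup v∉L u∈L)
    ... | no _     = cong suc (length-filter-≢ uniq u∈L)

    nimPos-edgeless : ∀ m {L} → Unique L → length L ≡ m → nimPos (gbot ∷ map gvert L) ≡ m % 2
    nimPos-edgeless zero    {[]}        _    _   = refl
    nimPos-edgeless (suc m) {L@(_ ∷ _)} uniq len =
      trans (nimPos-unfold S) (mex-constant m (options S) every-option some-option)
      where
      S : List (GElem V)
      S = gbot ∷ map gvert L
      after-move : ∀ {u} → u ∈ L → nimPos (remove (gvert u) S) ≡ m % 2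
      after-move {u} u∈L = trans (cong nimPos (remove-vertex u L))
        (nimPos-edgeless m (Unique.filter⁺ (u ≢?_) uniq) (suc-injective (trans (length-filter-≢ uniq u∈L) len)))
      every-option : ∀ {v} → v ∈ options S → v ≡ m % 2
      every-option v∈ with ∈-options⁻ {S = S} v∈
      ... | gbot      , _        , x≢bot , _  = contradiction refl x≢bot
      ... | gvert _   , there x∈ , _     , v≡ with ∈-map⁻ gvert x∈
      ...   | _ , u∈L , refl = trans v≡ (after-move u∈L)
      every-option v∈ | gedge _ _ , there x∈ , _ , _ with ∈-map⁻ gvert x∈
      ...   | _ , _ , ()
      some-option : m % 2 ∈ options S
      some-option = subst (_∈ options S) (after-move (here refl)) (∈-options⁺ {S = S} (there (here refl)) λ ())

swapPairs : ∀ {n} → Subset n → Subset n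
swapPairs []          = []
swapPairs (a ∷ [])    = a ∷ []
swapPairs (a ∷ b ∷ s) = b ∷ a ∷ swapPairs s

swapPairs-involutive : ∀ {n} (s : Subset n) → swapPairs (swapPairs s) ≡ s
swapPairs-involutive []          = refl
swapPairs-involutive (a ∷ [])    = refl
swapPairs-involutive (a ∷ b ∷ s) = cong (λ t → a ∷ b ∷ t) (swapPairs-involutive s)

swapPairs-injective : ∀ {n} {s t : Subset n} → swapPairs s ≡ swapPairs t → s ≡ t
swapPairs-injective {s = s} {t} eq =
  trans (sym (swapPairs-involutive s)) (trans (cong swapPairs eq) (swapPairs-involutive t))

swapPairs-≢ : ∀ {n} {s t : Subset n} → s ≢ t → swapPairs s ≢ swapPairs t
swapPairs-≢ s≢t = s≢t ∘ swapPairs-injective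

swapPairs-∩ : ∀ {n} (s t : Subset n) → swapPairs (s ∩ t) ≡ swapPairs s ∩ swapPairs t
swapPairs-∩ []          []          = refl
swapPairs-∩ (a ∷ [])    (c ∷ [])    = refl
swapPairs-∩ (a ∷ b ∷ s) (c ∷ d ∷ t) = cong (λ r → (b ∧ d) ∷ (a ∧ c) ∷ r) (swapPairs-∩ s t)

∣swapPairs∣ : ∀ {n} (s : Subset n) → ∣ swapPairs s ∣ ≡ ∣ s ∣
∣swapPairs∣ []                  = refl
∣swapPairs∣ (a ∷ [])            = refl
∣swapPairs∣ (true  ∷ true  ∷ s) = cong (suc ∘ suc) (∣swapPairs∣ s)
∣swapPairs∣ (true  ∷ false ∷ s) = cong suc (∣swapPairs∣ s)
∣swapPairs∣ (false ∷ true  ∷ s) = cong suc (∣swapPairs∣ s)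
∣swapPairs∣ (false ∷ false ∷ s) = ∣swapPairs∣ s

∣swapPairs-∩∣ : ∀ {n} (s t : Subset n) → ∣ swapPairs s ∩ swapPairs t ∣ ≡ ∣ s ∩ t ∣
∣swapPairs-∩∣ s t = trans (cong ∣_∣ (sym (swapPairs-∩ s t))) (∣swapPairs∣ (s ∩ t))

swapPairs-fixed-even : ∀ m (s : Subset (m * 2)) → s ≡ swapPairs s → 2 ∣ ∣ s ∣
swapPairs-fixed-even zero    []                  _  = 2 ∣0
swapPairs-fixed-even (suc m) (true  ∷ true  ∷ s) eq =
  ∣m∣n⇒∣m+n (∣-refl {2}) (swapPairs-fixed-even m s (∷-injectiveʳ (∷-injectiveʳ eq)))
swapPairs-fixed-even (suc m) (false ∷ false ∷ s) eq =
  swapPairs-fixed-even m s (∷-injectiveʳ (∷-injectiveʳ eq))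

infix 4 _≺_

data _≺_ : ∀ {n} → Subset n → Subset n → Set where
  this : ∀ {n} {s t : Subset n} → false ∷ s ≺ true ∷ t
  next : ∀ {n b} {s t : Subset n} → s ≺ t → b ∷ s ≺ b ∷ t

private
  ≺-cmp-∷ : ∀ {n b} {s t : Subset n} → Tri (s ≺ t) (s ≡ t) (t ≺ s) →
            Tri (b ∷ s ≺ b ∷ t) (b ∷ s ≡ b ∷ t) (b ∷ t ≺ b ∷ s)
  ≺-cmp-∷ (tri< s≺t s≢t t⊀s) = tri< (next s≺t) (s≢t ∘ ∷-injectiveʳ) λ { (next t≺s) → t⊀s t≺s }
  ≺-cmp-∷ (tri≈ s⊀t refl t⊀s) = tri≈ (λ { (next s≺t) → s⊀t s≺t }) refl (λ { (next t≺s) → t⊀s t≺s })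
  ≺-cmp-∷ (tri> s⊀t s≢t t≺s) = tri> (λ { (next s≺t) → s⊀t s≺t }) (s≢t ∘ ∷-injectiveʳ) (next t≺s)

≺-cmp : ∀ {n} → Trichotomous _≡_ (_≺_ {n})
≺-cmp []          []          = tri≈ (λ ()) refl (λ ())
≺-cmp (false ∷ s) (true  ∷ t) = tri< this (λ ()) (λ ())
≺-cmp (true  ∷ s) (false ∷ t) = tri> (λ ()) (λ ()) this
≺-cmp (false ∷ s) (false ∷ t) = ≺-cmp-∷ (≺-cmp s t)
≺-cmp (true  ∷ s) (true  ∷ t) = ≺-cmp-∷ (≺-cmp s t)

≺-asym : ∀ {n} → Asymmetric (_≺_ {n})
≺-asym = tri⇒asym ≺-cmp

≺⇒≢ : ∀ {n} {s t : Subset n} → s ≺ t → s ≢ t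
≺⇒≢ s≺t refl = ≺-asym s≺t s≺t

allSubsets-sorted : ∀ n → AllPairs _≺_ (allSubsets n)
allSubsets-sorted zero    = All.[] ∷ []
allSubsets-sorted (suc n) = AllPairs.++⁺ (AllPairs.map⁺ (AllPairs.map next sorted))
                                         (AllPairs.map⁺ (AllPairs.map next sorted))
                                         (All.tabulate λ s∈ → All.tabulate λ t∈ → false-first s∈ t∈)
  where
  sorted : AllPairs _≺_ (allSubsets n)
  sorted = allSubsets-sorted n
  false-first : ∀ {s t} → s ∈ map (false ∷_) (allSubsets n) → t ∈ map (true ∷_) (allSubsets n) → s ≺ t
  false-first s∈ t∈ with ∈-map⁻ (false ∷_) s∈ | ∈-map⁻ (true ∷_) t∈
  ... | _ , _ , refl | _ , _ , refl = this

∈-allSubsets : ∀ {n} (s : Subset n) → s ∈ allSubsets n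
∈-allSubsets []          = here refl
∈-allSubsets {suc n} (false ∷ s) = ∈-++⁺ˡ (∈-map⁺ (false ∷_) (∈-allSubsets s))
∈-allSubsets {suc n} (true  ∷ s) = ∈-++⁺ʳ (map (false ∷_) (allSubsets n)) (∈-map⁺ (true ∷_) (∈-allSubsets s))

countSubsets : ∀ n {p} {P : Pred (Subset n) p} → Decidable P → ℕ
countSubsets n P? = length (filter P? (allSubsets n))

countSubsets-suc : ∀ n {p} {P : Pred (Subset (suc n)) p} (P? : Decidable P) →
  countSubsets (suc n) P? ≡ countSubsets n (P? ∘ (false ∷_)) + countSubsets n (P? ∘ (true ∷_))
countSubsets-suc n P? = begin
  length (filter P? (map (false ∷_) Ss ++ map (true ∷_) Ss))
    ≡⟨ cong length (filter-++ P? (map (false ∷_) Ss) (map (true ∷_) Ss)) ⟩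
  length (filter P? (map (false ∷_) Ss) ++ filter P? (map (true ∷_) Ss))
    ≡⟨ length-++ (filter P? (map (false ∷_) Ss)) ⟩
  length (filter P? (map (false ∷_) Ss)) + length (filter P? (map (true ∷_) Ss))
    ≡⟨ cong₂ _+_ (length-filter-map P? (false ∷_) Ss) (length-filter-map P? (true ∷_) Ss) ⟩
  countSubsets n (P? ∘ (false ∷_)) + countSubsets n (P? ∘ (true ∷_)) ∎
  where
  open ≡-Reasoning
  Ss : List (Subset n)
  Ss = allSubsets n

countSubsets-none : ∀ n {p} {P : Pred (Subset n) p} (P? : Decidable P) → (∀ s → ¬ P s) → countSubsets n P? ≡ 0
countSubsets-none n P? none = cong length (filter-none P? (All.universal none (allSubsets n)))

SymmetricOfSize : ∀ {n} → ℕ → Subset n → Set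
SymmetricOfSize k s = ∣ s ∣ ≡ k × s ≡ swapPairs s

symmetricOfSize? : ∀ {n} k → Decidable (SymmetricOfSize {n} k)
symmetricOfSize? k s = (∣ s ∣ ≟ℕ k) ×-dec subsetEq s (swapPairs s)

countSymmetric : ℕ → ℕ → ℕ
countSymmetric n k = countSubsets n (symmetricOfSize? k)

countSymmetric-split : ∀ n k → countSymmetric (suc (suc n)) k ≡
  countSymmetric n k + countSubsets n (symmetricOfSize? k ∘ (true ∷_) ∘ (true ∷_))
countSymmetric-split n k = begin
  countSymmetric (suc (suc n)) k
    ≡⟨ countSubsets-suc (suc n) _ ⟩
  countSubsets (suc n) (P? ∘ (false ∷_)) + countSubsets (suc n) (P? ∘ (true ∷_))
    ≡⟨ cong₂ _+_ (countSubsets-suc n _) (countSubsets-suc n _) ⟩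
  (countSubsets n (P? ∘ (false ∷_) ∘ (false ∷_)) + countSubsets n (P? ∘ (false ∷_) ∘ (true ∷_))) +
  (countSubsets n (P? ∘ (true ∷_) ∘ (false ∷_)) + countSubsets n (P? ∘ (true ∷_) ∘ (true ∷_)))
    ≡⟨ cong₂ _+_ (cong₂ _+_ (cong length (filter-≐ _ _ (unpad , pad) (allSubsets n)))
                            (countSubsets-none n _ λ _ ()))
                 (cong (_+ rest) (countSubsets-none n _ λ _ ())) ⟩
  (countSymmetric n k + 0) + rest
    ≡⟨ cong (_+ rest) (+-identityʳ (countSymmetric n k)) ⟩
  countSymmetric n k + rest ∎
  where
  open ≡-Reasoning
  P? : ∀ {n} → Decidable (SymmetricOfSize {n} k)
  P? = symmetricOfSize? k
  rest : ℕ
  rest = countSubsets n (P? ∘ (true ∷_) ∘ (true ∷_))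
  unpad : ∀ {s : Subset n} → SymmetricOfSize k (false ∷ false ∷ s) → SymmetricOfSize k s
  unpad (size , fixed) = size , ∷-injectiveʳ (∷-injectiveʳ fixed)
  pad : ∀ {s : Subset n} → SymmetricOfSize k s → SymmetricOfSize k (false ∷ false ∷ s)
  pad (size , fixed) = size , cong (λ t → false ∷ false ∷ t) fixed

countSymmetric-<2 : ∀ n k → k < 2 → countSymmetric (suc (suc n)) k ≡ countSymmetric n k
countSymmetric-<2 n k k<2 = begin
  countSymmetric (suc (suc n)) k
    ≡⟨ countSymmetric-split n k ⟩
  countSymmetric n k + countSubsets n (symmetricOfSize? k ∘ (true ∷_) ∘ (true ∷_))
    ≡⟨ cong (countSymmetric n k +_) (countSubsets-none n _ tooLarge) ⟩
  countSymmetric n k + 0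
    ≡⟨ +-identityʳ (countSymmetric n k) ⟩
  countSymmetric n k ∎
  where
  open ≡-Reasoning
  tooLarge : ∀ s → ¬ SymmetricOfSize k (true ∷ true ∷ s)
  tooLarge s (size , _) = <⇒≱ k<2 (subst (2 ≤_) size (s≤s (s≤s z≤n)))

countSymmetric-+2 : ∀ n j →
  countSymmetric (suc (suc n)) (suc (suc j)) ≡ countSymmetric n (suc (suc j)) + countSymmetric n j
countSymmetric-+2 n j = trans (countSymmetric-split n (suc (suc j)))
  (cong (countSymmetric n (suc (suc j)) +_) (cong length (filter-≐ _ _ (unpad , pad) (allSubsets n))))
  where
  unpad : ∀ {s : Subset n} → SymmetricOfSize (suc (suc j)) (true ∷ true ∷ s) → SymmetricOfSize j s
  unpad (size , fixed) = suc-injective (suc-injective size) , ∷-injectiveʳ (∷-injectiveʳ fixed)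
  pad : ∀ {s : Subset n} → SymmetricOfSize j s → SymmetricOfSize (suc (suc j)) (true ∷ true ∷ s)
  pad (size , fixed) = cong (suc ∘ suc) size , cong (λ t → true ∷ true ∷ t) fixed

%-+-cong : ∀ d .{{_ : NonZero d}} {a a′ b b′} →
           a % d ≡ a′ % d → b % d ≡ b′ % d → (a + b) % d ≡ (a′ + b′) % d
%-+-cong d {a} {a′} {b} {b′} a≡ b≡ = begin
  (a + b) % d            ≡⟨ %-distribˡ-+ a b d ⟩
  (a % d + b % d) % d    ≡⟨ cong₂ (λ x y → (x + y) % d) a≡ b≡ ⟩
  (a′ % d + b′ % d) % d  ≡⟨ %-distribˡ-+ a′ b′ d ⟨
  (a′ + b′) % d          ∎
  where open ≡-Reasoning

pascal²-%2 : ∀ n j → (suc (suc n) C suc (suc j)) % 2 ≡ (n C suc (suc j) + n C j) % 2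
pascal²-%2 n j = begin
  (suc (suc n) C suc (suc j)) % 2
    ≡⟨ cong (_% 2) pascal² ⟩
  ((n C j + n C suc j) + (n C suc j + n C suc (suc j))) % 2
    ≡⟨ cong (_% 2) (rearrange (n C j) (n C suc j) (n C suc (suc j))) ⟩
  ((n C suc (suc j) + n C j) + (n C suc j) * 2) % 2
    ≡⟨ [m+kn]%n≡m%n (n C suc (suc j) + n C j) (n C suc j) 2 ⟩
  (n C suc (suc j) + n C j) % 2 ∎
  where
  open ≡-Reasoning
  pascal² : suc (suc n) C suc (suc j) ≡ (n C j + n C suc j) + (n C suc j + n C suc (suc j))
  pascal² = sym (trans (cong₂ _+_ (nCk+nC[k+1]≡[n+1]C[k+1] n j) (nCk+nC[k+1]≡[n+1]C[k+1] n (suc j)))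
                       (nCk+nC[k+1]≡[n+1]C[k+1] (suc n) (suc j)))
  rearrange : ∀ x y z → (x + y) + (y + z) ≡ (z + x) + y * 2
  rearrange = solve-∀

countSymmetric-parity : ∀ m k → countSymmetric (m * 2) k % 2 ≡ ((m * 2) C k) % 2
countSymmetric-parity zero    zero          = refl
countSymmetric-parity zero    (suc k)       = refl
countSymmetric-parity (suc m) zero          =
  trans (cong (_% 2) (countSymmetric-<2 (m * 2) 0 (s≤s z≤n))) (countSymmetric-parity m 0)
countSymmetric-parity (suc m) (suc zero)    = begin
  countSymmetric (suc (suc n)) 1 % 2  ≡⟨ cong (_% 2) (countSymmetric-<2 n 1 (s≤s (s≤s z≤n))) ⟩
  countSymmetric n 1 % 2              ≡⟨ countSymmetric-parity m 1 ⟩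
  (n C 1) % 2                         ≡⟨ cong (_% 2) (nC1≡n n) ⟩
  suc (suc n) % 2                     ≡⟨ cong (_% 2) (nC1≡n (suc (suc n))) ⟨
  (suc (suc n) C 1) % 2               ∎
  where
  open ≡-Reasoning
  n : ℕ
  n = m * 2
countSymmetric-parity (suc m) (suc (suc j)) = begin
  countSymmetric (suc (suc n)) (suc (suc j)) % 2
    ≡⟨ cong (_% 2) (countSymmetric-+2 n j) ⟩
  (countSymmetric n (suc (suc j)) + countSymmetric n j) % 2
    ≡⟨ %-+-cong 2 {countSymmetric n (suc (suc j))} {n C suc (suc j)} {countSymmetric n j} {n C j}
                  (countSymmetric-parity m (suc (suc j))) (countSymmetric-parity m j) ⟩
  (n C suc (suc j) + n C j) % 2
    ≡⟨ pascal²-%2 n j ⟨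
  (suc (suc n) C suc (suc j)) % 2 ∎
  where
  open ≡-Reasoning
  n : ℕ
  n = m * 2

2∣[x+1]⇒¬2∣x : ∀ {x} → 2 ∣ x + 1 → ¬ 2 ∣ x
2∣[x+1]⇒¬2∣x 2∣x+1 2∣x with ∣1⇒≡1 (∣m+n∣m⇒∣n 2∣x+1 2∣x)
... | ()

module JohnsonSymmetry (m k : ℕ) (2∣k : 2 ∣ k) where

  n : ℕ
  n = m * 2

  open GraphPoset (subsetEq {n})
  open GraphPosetProperties (subsetEq {n})

  vertices : List (Subset n)
  vertices = kSubsets n k

  edges : List (Subset n × Subset n)
  edges = johnsonEdges n k

  -- johnsonEdges lists an edge {a , b} only as (a , b) with a before b in
  -- allSubsets, that is a ≺ b, so σ must re-orient the image of an edge.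
  orient : Subset n → Subset n → GElem (Subset n)
  orient c d with ≺-cmp c d
  ... | tri< _ _ _ = gedge c d
  ... | tri≈ _ _ _ = gedge c d
  ... | tri> _ _ _ = gedge d c

  orient-≺ : ∀ {c d} → c ≺ d → orient c d ≡ gedge c d
  orient-≺ {c} {d} c≺d with ≺-cmp c d
  ... | tri< _ _ _   = refl
  ... | tri≈ _ _ _   = refl
  ... | tri> c⊀d _ _ = contradiction c≺d c⊀d

  orient-≻ : ∀ {c d} → d ≺ c → orient c d ≡ gedge d c
  orient-≻ {c} {d} d≺c with ≺-cmp c d
  ... | tri< _ _ d⊀c = contradiction d≺c d⊀c
  ... | tri≈ _ _ d⊀c = contradiction d≺c d⊀c
  ... | tri> _ _ _   = refl

  orient-cases : ∀ {c d} → c ≢ d →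
                 (c ≺ d × orient c d ≡ gedge c d) ⊎ (d ≺ c × orient c d ≡ gedge d c)
  orient-cases {c} {d} c≢d with ≺-cmp c d
  ... | tri< c≺d _ _ = inj₁ (c≺d , refl)
  ... | tri≈ _ c≡d _ = contradiction c≡d c≢d
  ... | tri> _ _ d≺c = inj₂ (d≺c , refl)

  vertex≤orientˡ : ∀ c d → leG (gvert c) (orient c d) ≡ true
  vertex≤orientˡ c d with ≺-cmp c d
  ... | tri< _ _ _ = vertex≤edgeˡ c d
  ... | tri≈ _ _ _ = vertex≤edgeˡ c d
  ... | tri> _ _ _ = vertex≤edgeʳ d c

  vertex≤orientʳ : ∀ c d → leG (gvert d) (orient c d) ≡ true
  vertex≤orientʳ c d with ≺-cmp c d
  ... | tri< _ _ _ = vertex≤edgeʳ c d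
  ... | tri≈ _ _ _ = vertex≤edgeʳ c d
  ... | tri> _ _ _ = vertex≤edgeˡ d c

  σ : GElem (Subset n) → GElem (Subset n)
  σ gbot        = gbot
  σ (gvert u)   = gvert (swapPairs u)
  σ (gedge a b) = orient (swapPairs a) (swapPairs b)

  Valid : GElem (Subset n) → Set
  Valid (gedge a b) = a ≺ b × ∣ a ∩ b ∣ + 1 ≡ k
  Valid _           = ⊤

  σ-involutive : ∀ {x} → Valid x → σ (σ x) ≡ x
  σ-involutive {gbot}      _ = refl
  σ-involutive {gvert u}   _ = cong gvert (swapPairs-involutive u)
  σ-involutive {gedge a b} (a≺b , _) with orient-cases (swapPairs-≢ (≺⇒≢ a≺b))
  ... | inj₁ (_ , σe≡) rewrite σe≡ | swapPairs-involutive a | swapPairs-involutive b = orient-≺ a≺b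
  ... | inj₂ (_ , σe≡) rewrite σe≡ | swapPairs-involutive a | swapPairs-involutive b = orient-≻ a≺b

  σ-monotone : ∀ {x y} → leG x y ≡ true → leG (σ x) (σ y) ≡ true
  σ-monotone {gbot}                _    = refl
  σ-monotone {gvert u} {gvert v}   u≤v  rewrite eqB⇒≡ {u} {v} u≤v = leG-refl (gvert (swapPairs v))
  σ-monotone {gvert u} {gedge a b} u≤ab with vertex-of-edge {u} {a} {b} u≤ab
  ... | inj₁ refl = vertex≤orientˡ (swapPairs a) (swapPairs b)
  ... | inj₂ refl = vertex≤orientʳ (swapPairs a) (swapPairs b)
  σ-monotone {gedge a b} {y}       ab≤y rewrite edge-maximal y ab≤y = leG-refl (σ (gedge a b))

  edge-not-fixed : ∀ {a b} → Valid (gedge a b) → gedge a b ≢ σ (gedge a b)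
  edge-not-fixed {a} {b} (a≺b , adjacent) e≡σe =
    2∣[x+1]⇒¬2∣x (subst (2 ∣_) (sym adjacent) 2∣k) (swapPairs-fixed-even m (a ∩ b) (sym swap-fixes-a∩b))
    where
    swap-fixes-a∩b : swapPairs (a ∩ b) ≡ a ∩ b
    swap-fixes-a∩b with orient-cases (swapPairs-≢ (≺⇒≢ a≺b))
    ... | inj₁ (_ , σe≡) with gedge-injective (trans e≡σe σe≡)
    ...   | a≡ , b≡ = trans (swapPairs-∩ a b) (sym (cong₂ _∩_ a≡ b≡))
    swap-fixes-a∩b | inj₂ (_ , σe≡) with gedge-injective (trans e≡σe σe≡)
    ...   | a≡ , b≡ = trans (swapPairs-∩ a b) (trans (sym (cong₂ _∩_ b≡ a≡)) (∩-comm b a))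

  fixed-downClosed : ∀ {x z} → Valid z → leG x z ≡ true → z ≡ σ z → x ≡ σ x
  fixed-downClosed {x}       {gbot}      _  x≤z _    rewrite below-bot x x≤z = refl
  fixed-downClosed {gbot}    {gvert v}   _  _   _    = refl
  fixed-downClosed {gvert u} {gvert v}   _  u≤v v≡σv rewrite eqB⇒≡ {u} {v} u≤v = v≡σv
  fixed-downClosed {_}       {gedge a b} ve _   z≡σz = contradiction z≡σz (edge-not-fixed ve)

  ≰-mirror : ∀ {x} → x ≢ σ x → ¬ (leG x (σ x) ≡ true)
  ≰-mirror {gbot}      x≢σx _    = x≢σx refl
  ≰-mirror {gvert u}   x≢σx u≤σu = x≢σx (cong gvert (eqB⇒≡ u≤σu))
  ≰-mirror {gedge a b} x≢σx e≤σe = x≢σx (sym (edge-maximal (σ (gedge a b)) e≤σe))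

  open Chomp (johnsonPoset n k)
  open ChompProperties (johnsonPoset n k) leG-refl
  open MirrorStrategy σ Valid σ-involutive (λ {x} {y} → σ-monotone {x} {y}) refl fixed-downClosed ≰-mirror
  open EdgelessChomp vertices edges using (nimPos-edgeless)

  vertices-sorted : AllPairs _≺_ vertices
  vertices-sorted = AllPairs.filter⁺ _ (allSubsets-sorted n)

  swapPairs-vertex : ∀ {u} → u ∈ vertices → swapPairs u ∈ vertices
  swapPairs-vertex {u} u∈ = ∈-filter⁺ _ (∈-allSubsets (swapPairs u))
    (trans (∣swapPairs∣ u) (proj₂ (∈-filter⁻ _ {xs = allSubsets n} u∈)))

  ∈-edges⁻ : ∀ {a b} → (a , b) ∈ edges → a ∈ vertices × b ∈ vertices × Valid (gedge a b)
  ∈-edges⁻ ab∈ with ∈-filter⁻ _ ab∈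
  ... | ab∈pairs , adjacent with ∈-pairs⁻ vertices-sorted ab∈pairs
  ...   | a∈ , b∈ , a≺b = a∈ , b∈ , a≺b , adjacent

  ∈-edges⁺ : ∀ {a b} → a ∈ vertices → b ∈ vertices → Valid (gedge a b) → (a , b) ∈ edges
  ∈-edges⁺ a∈ b∈ (a≺b , adjacent) = ∈-filter⁺ _ (∈-pairs⁺ ≺-asym vertices-sorted a∈ b∈ a≺b) adjacent

  elements : List (GElem (Subset n))
  elements = FinPoset.elems (johnsonPoset n k)

  data Element : GElem (Subset n) → Set where
    bot    : Element gbot
    vertex : ∀ {u} → u ∈ vertices → Element (gvert u)
    edge   : ∀ {a b} → (a , b) ∈ edges → Element (gedge a b)

  element-view : ∀ {x} → x ∈ elements → Element x
  element-view (here refl) = bot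
  element-view (there x∈) with ∈-++⁻ (map gvert vertices) x∈
  ... | inj₁ x∈vs with ∈-map⁻ gvert x∈vs
  ...   | _ , u∈ , refl = vertex u∈
  element-view (there x∈) | inj₂ x∈es with ∈-map⁻ _ x∈es
  ...   | _ , e∈ , refl = edge e∈

  element-∈ : ∀ {x} → Element x → x ∈ elements
  element-∈ bot         = here refl
  element-∈ (vertex u∈) = there (∈-++⁺ˡ (∈-map⁺ gvert u∈))
  element-∈ (edge e∈)   = there (∈-++⁺ʳ (map gvert vertices) (∈-map⁺ (λ e → gedge (proj₁ e) (proj₂ e)) e∈))

  element-valid : ∀ {x} → Element x → Valid x
  element-valid bot        = tt
  element-valid (vertex _) = tt
  element-valid (edge e∈)  = proj₂ (proj₂ (∈-edges⁻ e∈))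

  σ-element : ∀ {x} → Element x → Element (σ x)
  σ-element bot         = bot
  σ-element (vertex u∈) = vertex (swapPairs-vertex u∈)
  σ-element {gedge a b} (edge e∈) with ∈-edges⁻ e∈
  ... | a∈ , b∈ , a≺b , adjacent with orient-cases (swapPairs-≢ (≺⇒≢ a≺b))
  ...   | inj₁ (a′≺b′ , σe≡) rewrite σe≡ =
    edge (∈-edges⁺ (swapPairs-vertex a∈) (swapPairs-vertex b∈)
                   (a′≺b′ , trans (cong (_+ 1) (∣swapPairs-∩∣ a b)) adjacent))
  ...   | inj₂ (b′≺a′ , σe≡) rewrite σe≡ =
    edge (∈-edges⁺ (swapPairs-vertex b∈) (swapPairs-vertex a∈)
                   (b′≺a′ , trans (cong (λ s → ∣ s ∣ + 1) (∩-comm (swapPairs b) (swapPairs a)))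
                                  (trans (cong (_+ 1) (∣swapPairs-∩∣ a b)) adjacent)))

  elements-symmetric : Symmetric elements
  elements-symmetric = record
    { valid  = element-valid ∘ element-view
    ; closed = element-∈ ∘ σ-element ∘ element-view
    }

  symmetricVertices : List (Subset n)
  symmetricVertices = filter (λ u → subsetEq u (swapPairs u)) vertices

  fixedPart-elements : fixedPart elements ≡ gbot ∷ map gvert symmetricVertices
  fixedPart-elements = cong (gbot ∷_) (begin
    fixedPart (map gvert vertices ++ map edgeOf edges)             ≡⟨ filter-++ fixed? (map gvert vertices) _ ⟩
    fixedPart (map gvert vertices) ++ fixedPart (map edgeOf edges) ≡⟨ cong₂ _++_ fixed-vertices fixed-edges ⟩
    map gvert symmetricVertices ++ []                              ≡⟨ ++-identityʳ _ ⟩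
    map gvert symmetricVertices                                    ∎)
    where
    open ≡-Reasoning
    edgeOf : Subset n × Subset n → GElem (Subset n)
    edgeOf e = gedge (proj₁ e) (proj₂ e)
    fixed-vertices : fixedPart (map gvert vertices) ≡ map gvert symmetricVertices
    fixed-vertices = trans (filter-map fixed? gvert vertices)
      (cong (map gvert) (filter-≐ _ _ (gvert-injective , cong gvert) vertices))
    not-fixed : ∀ {x} → ∃ (λ e → e ∈ edges × x ≡ edgeOf e) → x ≢ σ x
    not-fixed (_ , e∈ , refl) = edge-not-fixed (proj₂ (proj₂ (∈-edges⁻ e∈)))
    fixed-edges : fixedPart (map edgeOf edges) ≡ []
    fixed-edges = filter-none fixed? (All.tabulate (not-fixed ∘ ∈-map⁻ edgeOf))

  symmetricVertices-unique : Unique symmetricVertices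
  symmetricVertices-unique =
    Unique.filter⁺ _ (Unique.filter⁺ _ (AllPairs.map ≺⇒≢ (allSubsets-sorted n)))

  length-symmetricVertices : length symmetricVertices ≡ countSymmetric n k
  length-symmetricVertices = cong length (filter-filter _ _ (allSubsets n))

  nimJohnson≡countSymmetric : nimJohnson n k ≡ countSymmetric n k % 2
  nimJohnson≡countSymmetric = begin
    nimPos elements                              ≡⟨ nimPos-fixedPart elements elements-symmetric ⟩
    nimPos (fixedPart elements)                  ≡⟨ cong nimPos fixedPart-elements ⟩
    nimPos (gbot ∷ map gvert symmetricVertices)  ≡⟨ nimPos-edgeless _ symmetricVertices-unique
                                                                    length-symmetricVertices ⟩
    countSymmetric n k % 2                       ∎
    where open ≡-Reasoning

proposition3p2 : (n k : ℕ) → k ≤ n → 2 ∣ k → 2 ∣ n →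
    nimJohnson n k ≡ (n C k) % 2
proposition3p2 _ k _ 2∣k (divides m refl) =
  trans (JohnsonSymmetry.nimJohnson≡countSymmetric m k 2∣k) (countSymmetric-parity m k)
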